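{- $Y_v\simeq_{nai}\Theta_v$, where $Y_v=\lambda x.\Xi_v\Xi_v$ with $\Xi_v=\lambda z.x(\lambda y.zzy)$, and $\Theta_v=(\lambda z.\lambda x.x(\lambda y.zzxy))(\lambda z.\lambda x.x(\lambda y.zzxy))$.
   Context: Plotkin terms $t::=v\mid tu$, values $v::=x\mid\lambda x.t$. Root rule $(\lambda x.t)v\mapsto t\{x:=v\}$ ($v$ value); weak reduction $\to_w$ is its closure under $W::=\langle\cdot\rangle\mid tW\mid Wt$. $t\Downarrow_wn$: $t\to_w^*n$ with $n$ $\to_w$-normal. Naive simulation: $R$ such that whenever $tRt'$ one of: $t$ has no $\to_w$-normal form; $t\Downarrow_wx$ and $t'\Downarrow_wx$; $t\Downarrow_w\lambda x.t_1$ and $t'\Downarrow_w\lambda x.t_1'$ with $t_1Rt_1'$; $t\Downarrow_wn_1n_2$ and $t'\Downarrow_wn_1'n_2'$ with $n_1Rn_1'$, $n_2Rn_2'$. Naive bisimilarity: $t\simeq_{nai}u$ iff there is $R$ with $tRu$ such that $R$ and its converse are naive simulations. -}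

module Defs where

open import Data.Nat using (ℕ; zero; suc; _+_; _∸_; _<ᵇ_; _≡ᵇ_)
open import Data.Bool using (if_then_else_)
open import Data.Product using (Σ; _×_; ∃)
open import Data.Sum using (_⊎_)
open import Relation.Nullary using (¬_)
open import Relation.Binary.Construct.Closure.ReflexiveTransitive using (Star)
open import Level using (Level)

data Term : Set where
  var : ℕ → Term
  lam : Term → Term
  app : Term → Term → Term

data IsValue : Term → Set where
  var-val : ∀ i → IsValue (var i)
  lam-val : ∀ t → IsValue (lam t)

shift : ℕ → ℕ → Term → Term
shift d c (var i) = if i <ᵇ c then var i else var (i + d)
shift d c (lam t) = lam (shift d (suc c) t)
shift d c (app t u) = app (shift d c t) (shift d c u)

-- sub k s t : substitute s for index k in t (t under k binders), removing that binder
sub : ℕ → Term → Term → Term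
sub k s (var i) = if i <ᵇ k then var i else (if i ≡ᵇ k then shift k 0 s else var (i ∸ 1))
sub k s (lam t) = lam (sub (suc k) s t)
sub k s (app t u) = app (sub k s t) (sub k s u)

-- t{x:=v} where t is the body of λx.t
_[_] : Term → Term → Term
t [ v ] = sub 0 v t

infix 4 _→w_
data _→w_ : Term → Term → Set where
  βv   : ∀ {t v} → IsValue v → app (lam t) v →w t [ v ]
  appR : ∀ {t u u'} → u →w u' → app t u →w app t u'
  appL : ∀ {t t' u} → t →w t' → app t u →w app t' u

_→w*_ : Term → Term → Set
_→w*_ = Star _→w_

Normal : Term → Set
Normal t = ¬ (∃ λ u → t →w u)

_⇓w_ : Term → Term → Set
t ⇓w n = (t →w* n) × Normal n

HasNF : Term → Set
HasNF t = ∃ λ n → t ⇓w n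

NaiveSim : ∀ {ℓ} → (Term → Term → Set ℓ) → Set ℓ
NaiveSim R = ∀ {t t'} → R t t' →
    (¬ HasNF t)
  ⊎ (Σ ℕ λ x → t ⇓w var x × t' ⇓w var x)
  ⊎ (Σ Term λ t₁ → Σ Term λ t₁' → t ⇓w lam t₁ × t' ⇓w lam t₁' × R t₁ t₁')
  ⊎ (Σ Term λ n₁ → Σ Term λ n₂ → Σ Term λ n₁' → Σ Term λ n₂' →
       t ⇓w app n₁ n₂ × t' ⇓w app n₁' n₂' × R n₁ n₁' × R n₂ n₂')

_≃nai_ : Term → Term → Set₁
t ≃nai u = Σ (Term → Term → Set) λ R → R t u × NaiveSim R × NaiveSim (λ a b → R b a)

-- Ξv = λz. x (λy. z z y)   (x free, index 1 under λz)
Ξv : Term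
Ξv = lam (app (var 1) (lam (app (app (var 1) (var 1)) (var 0))))

Yv : Term
Yv = lam (app Ξv Ξv)

Θhalf : Term
Θhalf = lam (lam (app (var 0) (lam (app (app (app (var 2) (var 2)) (var 1)) (var 0)))))

Θv : Term
Θv = app Θhalf Θhalf

module Submission where

open import Defs
open import Data.Nat using (ℕ; suc)
open import Data.Nat.Properties using (+-identityʳ; +-comm)
open import Data.Product using (_,_)
open import Data.Sum using (inj₁; inj₂)
open import Function using (flip; _∘_)
open import Relation.Binary.PropositionalEquality using (_≡_; cong; subst; subst₂)
open import Relation.Binary.Construct.Closure.ReflexiveTransitive using (ε; _◅_; gmap)

-- Both sides converge at every stage: Yv unfolds as λx. Ξ Ξ with Ξ Ξ ↦ x (λy. Ξ Ξ y), and Θv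
-- unfolds as λx. x (λy. Θv x y) with Θv x y ↦ x (λy. Θv x y) y.  The η-expanded recursive
-- calls λy. Ξ Ξ y and λy. Θv x y are values, hence normal, so the two naive unfolding trees
-- coincide node by node.

data MatchingNF (R : Term → Term → Set) : Term → Term → Set where
  vars : ∀ {t t' x} → t ⇓w var x → t' ⇓w var x → MatchingNF R t t'
  lams : ∀ {t t' b b'} → t ⇓w lam b → t' ⇓w lam b' → R b b' → MatchingNF R t t'
  apps : ∀ {t t' n₁ n₂ n₁' n₂'} → t ⇓w app n₁ n₂ → t' ⇓w app n₁' n₂' →
         R n₁ n₁' → R n₂ n₂' → MatchingNF R t t'

MatchingNF-flip : ∀ {R t t'} → MatchingNF R t t' → MatchingNF (flip R) t' t
MatchingNF-flip (vars t⇓ t'⇓) = vars t'⇓ t⇓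
MatchingNF-flip (lams t⇓ t'⇓ r) = lams t'⇓ t⇓ r
MatchingNF-flip (apps t⇓ t'⇓ r₁ r₂) = apps t'⇓ t⇓ r₁ r₂

matchingNF⇒naiveSim : ∀ {R} → (∀ {t t'} → R t t' → MatchingNF R t t') → NaiveSim R
matchingNF⇒naiveSim match r with match r
... | vars t⇓ t'⇓ = inj₂ (inj₁ (_ , t⇓ , t'⇓))
... | lams t⇓ t'⇓ rb = inj₂ (inj₂ (inj₁ (_ , _ , t⇓ , t'⇓ , rb)))
... | apps t⇓ t'⇓ r₁ r₂ = inj₂ (inj₂ (inj₂ (_ , _ , _ , _ , t⇓ , t'⇓ , r₁ , r₂)))

≃nai-byMatchingNF : ∀ {t u} (R : Term → Term → Set) → R t u →
                    (∀ {t t'} → R t t' → MatchingNF R t t') → t ≃nai u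
≃nai-byMatchingNF R r match =
  R , r , matchingNF⇒naiveSim match , matchingNF⇒naiveSim (MatchingNF-flip ∘ match)

data Neutral : Term → Set where
  var : ∀ {x} → Neutral (var x)
  app : ∀ {t u} → Neutral t → Normal u → Neutral (app t u)

lam-normal : ∀ {t} → Normal (lam t)
lam-normal (_ , ())

neutral-normal : ∀ {t} → Neutral t → Normal t
neutral-normal var (_ , ())
neutral-normal (app () _) (_ , βv _)
neutral-normal (app _ u-normal) (_ , appR u→) = u-normal (_ , u→)
neutral-normal (app t-neutral _) (_ , appL t→) = neutral-normal t-neutral (_ , t→)

-- Ξ⟨ m ⟩ is Ξv with its free x read as var m; Ξv is Ξ⟨ 0 ⟩.
Ξ⟨_⟩ : ℕ → Term
Ξ⟨ m ⟩ = lam (app (var (suc m)) (lam (app (app (var 1) (var 1)) (var 0))))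

fixY : ℕ → Term
fixY m = app Ξ⟨ m ⟩ Ξ⟨ m ⟩

fixΘ : ℕ → Term
fixΘ m = app Θv (var m)

-- λy. fix y, one binder deeper, so that x is var (suc m) inside.
ηY ηΘ : ℕ → Term
ηY m = lam (app (fixY (suc m)) (var 0))
ηΘ m = lam (app (fixΘ (suc m)) (var 0))

shift-Ξ : ∀ m → shift 1 0 Ξ⟨ m ⟩ ≡ Ξ⟨ suc m ⟩
shift-Ξ m = cong (λ k → lam (app (var (suc k)) (lam (app (app (var 1) (var 1)) (var 0)))))
                 (+-comm m 1)

fixY-unfold : ∀ m → fixY m →w app (var m) (ηY m)
fixY-unfold m = subst (λ Ξ′ → fixY m →w app (var m) (lam (app (app Ξ′ Ξ′) (var 0))))
                      (shift-Ξ m) (βv (lam-val _))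

Θv-unfold : Θv →w lam (app (var 0) (ηΘ 0))
Θv-unfold = βv (lam-val _)

fixΘ-unfold : ∀ m → fixΘ m →w* app (var m) (ηΘ m)
fixΘ-unfold m = appL Θv-unfold ◅ instantiate ◅ ε
  where
  instantiate : app (lam (app (var 0) (ηΘ 0))) (var m) →w app (var m) (ηΘ m)
  -- shift renders the substituted x as var (m + 0) and, under λy, var (m + 1).
  instantiate = subst₂ (λ a b → app (lam (app (var 0) (ηΘ 0))) (var m)
                                  →w app (var a) (lam (app (app Θv (var b)) (var 0))))
                       (+-identityʳ m) (+-comm m 1) (βv (var-val m))

unfolded-neutral : ∀ {m b} → Neutral (app (var m) (lam b))
unfolded-neutral = app var lam-normal

ηBody-neutral : ∀ {m b} → Neutral (app (app (var m) (lam b)) (var 0))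
ηBody-neutral = app unfolded-neutral (neutral-normal var)

data _~_ : Term → Term → Set where
  Yv~Θv : Yv ~ Θv
  fixY~unfolded : fixY 0 ~ app (var 0) (ηΘ 0)
  var~var : ∀ x → var x ~ var x
  η~η : ∀ m → ηY m ~ ηΘ m
  ηBody~ηBody : ∀ m → app (fixY m) (var 0) ~ app (fixΘ m) (var 0)
  unfolded~unfolded : ∀ m → app (var m) (ηY m) ~ app (var m) (ηΘ m)

~-matchingNF : ∀ {t t'} → t ~ t' → MatchingNF _~_ t t'
~-matchingNF Yv~Θv =
  lams (ε , lam-normal) (Θv-unfold ◅ ε , lam-normal) fixY~unfolded
~-matchingNF fixY~unfolded =
  apps (fixY-unfold 0 ◅ ε , neutral-normal unfolded-neutral)
       (ε , neutral-normal unfolded-neutral)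
       (var~var 0) (η~η 0)
~-matchingNF (var~var x) = vars (ε , neutral-normal var) (ε , neutral-normal var)
~-matchingNF (η~η m) = lams (ε , lam-normal) (ε , lam-normal) (ηBody~ηBody (suc m))
~-matchingNF (ηBody~ηBody m) =
  apps (appL (fixY-unfold m) ◅ ε , neutral-normal ηBody-neutral)
       (gmap (λ t → app t (var 0)) appL (fixΘ-unfold m) ,
        neutral-normal ηBody-neutral)
       (unfolded~unfolded m) (var~var 0)
~-matchingNF (unfolded~unfolded m) =
  apps (ε , neutral-normal unfolded-neutral)
       (ε , neutral-normal unfolded-neutral)
       (var~var m) (η~η m)

proposition6p3 : Yv ≃nai Θv
proposition6p3 = ≃nai-byMatchingNF _~_ Yv~Θv ~-matchingNF
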